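{- For integers $s\ge1$ and $k\ge1$, let $n=F_{s(2k+1)}/F_s$ (an integer). Then \[ e[n]=\frac{s(2k+1)2^{s(2k+1)}}{F_{s(2k+1)}}-\frac{s2^{s}}{F_{s}}+\frac{2}{F_{s}} =2sk+\frac{s+2}{F_{s}}-\frac{s(2k+1)}{F_{s(2k+1)}}. \]
   Context: $F_j\doteq2^j+1$. For an integer $n\ge1$, $e[n]$ is the expected number of fair coin tosses used by the bit-efficient scheme for choosing one of $n$ options uniformly. The scheme maintains a set of undecided equally likely toss sequences of the current length $t$ (probability $2^{ -t}$ each), starting with the empty sequence. After each toss, each undecided sequence splits into its two extensions. If there are now at least $n$ undecided sequences, $n$ of them are assigned one to each option, and the process stops if the observed sequence is among them; the rest remain undecided. Thus after $t$ tosses exactly $2^t\bmod n$ sequences are undecided. -}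

module Defs where

open import Data.Nat as ℕ using (ℕ; zero; suc; _^_; _≤ᵇ_)
import Data.Nat.Properties
open import Data.Bool using (if_then_else_)
open import Data.Integer as ℤ using (ℤ; +_)
open import Data.Rational as ℚ using (ℚ; _/_; 0ℚ)
open import Data.Product using (∃-syntax; _×_)

F : ℕ → ℕ
F j = suc (2 ^ j)

-- number of undecided sequences after t tosses when choosing among n options:
-- start with the empty sequence; each toss doubles the undecided set; if there
-- are at least n of them, n are assigned (decided) and the rest stay undecided.
undecided : ℕ → ℕ → ℕ
undecided n zero = 1
undecided n (suc t) =
  if n ≤ᵇ 2 ℕ.* undecided n t then 2 ℕ.* undecided n t ℕ.∸ n else 2 ℕ.* undecided n t

-- number of length-(t+1) sequences that get assigned at toss t+1
decidedAt : ℕ → ℕ → ℕ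
decidedAt n t = if n ≤ᵇ 2 ℕ.* undecided n t then n else 0

-- P(process stops exactly after t+1 tosses) * (t+1)
term : ℕ → ℕ → ℚ
term n t = (+ (suc t ℕ.* decidedAt n t)) / (2 ^ suc t)
  where instance _ = Data.Nat.Properties.m^n≢0 2 (suc t)

partialE : ℕ → ℕ → ℚ
partialE n zero = 0ℚ
partialE n (suc T) = partialE n T ℚ.+ term n T

ExpectedTosses≡ : ℕ → ℚ → Set
ExpectedTosses≡ n v =
  ∀ (ε : ℚ) → 0ℚ ℚ.< ε →
    ∃[ T₀ ] (∀ T → T₀ ℕ.≤ T → ℚ.∣ partialE n T ℚ.- v ∣ ℚ.< ε)

-- After t tosses undecided n t sequences of probability 2^-t remain, so e[n] is the sum of the
-- survival probabilities u_t / 2^t, u_t = undecided n t.  The count evolves by x ↦ 2x mod n,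
-- which for odd n maps complementary pairs x + y = n to complementary pairs.  For
-- n = F L / F s with L = M + s, the only assignment before toss L happens at toss M, leaving
-- u_L = n - 1; hence u_(L+i) + u_i = n for all i.  The tail of the series after L tosses is then
-- 2^-L (2n - e[n]), so e[n] = (A + 2n) / F L with A = 2^L Σ_{t<L} u_t / 2^t, and the two
-- explicit phases give A + n s 2^s = L 2^L.  The same reflection makes the scaled tail
-- 2L-periodic, so the partial sums are within O(T / 2^T) of the limit.
{-# OPTIONS --safe #-}
module Submission where

open import Defs
open import Data.Nat as ℕ using (ℕ; suc; _*_; _+_; _≤_; _^_)
open import Data.Nat.DivMod using (_/_)
open import Data.Integer using (+_)
open import Data.Rational as ℚ using (ℚ)
open import Data.Product using (_×_)
open import Relation.Binary.PropositionalEquality using (_≡_)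

open import Algebra.Properties.AbelianGroup using (∙-cancelʳ)
open import Data.Bool.Base using (true; false; if_then_else_; T)
open import Data.Integer as ℤ using (ℤ; _⊖_; +0; +[1+_]; -[1+_])
import Data.Integer.Properties as ℤP
open import Data.Integer.Tactic.RingSolver using () renaming (solve-∀ to ℤ-solve-∀)
open import Data.List.Base using (_∷_; [])
open import Data.Nat.Base using (zero; pred; _∸_; _⊔_; _%_; _<_; _≤ᵇ_; z≤n; NonZero; >-nonZero)
open import Data.Nat.Coprimality using (Coprime)
open import Data.Nat.DivMod using (m≡m%n+[m/n]*n; m%n<n; m/n*n≡m)
open import Data.Nat.Divisibility
  using (_∣_; divides; m∣m*n; n∣m*n; ∣-refl; ∣-trans; ∣1⇒≡1; ∣m+n∣m⇒∣n; ∣m∣n⇒∣m+n)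
open import Data.Nat.Properties
open import Data.Nat.Tactic.RingSolver using (solve-∀; solve)
open import Data.Product using (_,_)
open import Data.Rational using (mkℚ)
import Data.Rational.Properties as ℚP
open import Data.Rational.Unnormalised as ℚᵘ using (ℚᵘ; mkℚᵘ; *≡*; *<*)
import Data.Rational.Unnormalised.Properties as ℚᵘP
open import Data.Unit.Base using (tt)
open import Relation.Binary.PropositionalEquality
  using (refl; sym; trans; cong; cong₂; subst; subst₂; module ≡-Reasoning)
open import Relation.Nullary using (¬_; yes; no; contradiction)

m+q≡n+p⇒m⊖n≡p⊖q : ∀ m n p q → m + q ≡ n + p → m ⊖ n ≡ p ⊖ q
m+q≡n+p⇒m⊖n≡p⊖q m n p q eq = begin
  m ⊖ n             ≡⟨ ℤP.+-cancelˡ-⊖ q m n ⟨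
  (q + m) ⊖ (q + n) ≡⟨ cong₂ _⊖_ (trans (+-comm q m) eq) (+-comm q n) ⟩
  (n + p) ⊖ (n + q) ≡⟨ ℤP.+-cancelˡ-⊖ n p q ⟩
  p ⊖ q             ∎
  where open ≡-Reasoning

m⊖n+p⊖q≡m+p⊖n+q : ∀ m n p q → (m ⊖ n) ℤ.+ (p ⊖ q) ≡ (m + p) ⊖ (n + q)
m⊖n+p⊖q≡m+p⊖n+q m n p q = begin
  (m ⊖ n) ℤ.+ (p ⊖ q)             ≡⟨ cong₂ ℤ._+_ (ℤP.m-n≡m⊖n m n) (ℤP.m-n≡m⊖n p q) ⟨
  (+ m ℤ.- + n) ℤ.+ (+ p ℤ.- + q) ≡⟨ regroup (+ m) (+ n) (+ p) (+ q) ⟩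
  (+ m ℤ.+ + p) ℤ.- (+ n ℤ.+ + q) ≡⟨ cong₂ ℤ._-_ (ℤP.pos-+ m p) (ℤP.pos-+ n q) ⟨
  + (m + p) ℤ.- + (n + q)         ≡⟨ ℤP.m-n≡m⊖n (m + p) (n + q) ⟩
  (m + p) ⊖ (n + q)               ∎
  where
  open ≡-Reasoning
  regroup : ∀ a b c d → (a ℤ.- b) ℤ.+ (c ℤ.- d) ≡ (a ℤ.+ c) ℤ.- (b ℤ.+ d)
  regroup = ℤ-solve-∀

*-distribʳ-⊖ : ∀ m n k → (m ⊖ n) ℤ.* + k ≡ (m * k) ⊖ (n * k)
*-distribʳ-⊖ m n k = begin
  (m ⊖ n) ℤ.* + k                 ≡⟨ cong (ℤ._* + k) (ℤP.m-n≡m⊖n m n) ⟨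
  (+ m ℤ.- + n) ℤ.* + k           ≡⟨ distrib (+ m) (+ n) (+ k) ⟩
  (+ m ℤ.* + k) ℤ.- (+ n ℤ.* + k) ≡⟨ cong₂ ℤ._-_ (ℤP.pos-* m k) (ℤP.pos-* n k) ⟨
  + (m * k) ℤ.- + (n * k)         ≡⟨ ℤP.m-n≡m⊖n (m * k) (n * k) ⟩
  (m * k) ⊖ (n * k)               ∎
  where
  open ≡-Reasoning
  distrib : ∀ a b c → (a ℤ.- b) ℤ.* c ≡ a ℤ.* c ℤ.- b ℤ.* c
  distrib = ℤ-solve-∀

-- Formal fractions (x − y)/d over ℕ.  Through p ≈ᶠ f an identity between rationals reduces to
-- the cross-multiplied identity `Cross`, an equation over ℕ that the ring solver proves.
infix 5 _−_÷_
data Fraction : Set where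
  _−_÷_ : (x y d : ℕ) .{{_ : NonZero d}} → Fraction

⟦_⟧ : Fraction → ℚᵘ
⟦ x − y ÷ d ⟧ = (x ⊖ y) ℚᵘ./ d

infixl 4 _⊕_
_⊕_ : Fraction → Fraction → Fraction
(x − y ÷ d) ⊕ (z − w ÷ e) = ((x * e + z * d) − (y * e + w * d) ÷ (d * e)) {{m*n≢0 d e}}

⊝_ : Fraction → Fraction
⊝ (x − y ÷ d) = y − x ÷ d

Cross : Fraction → Fraction → Set
Cross (x − y ÷ d) (z − w ÷ e) = x * e + w * d ≡ y * e + z * d

⟦⟧-⊕ : ∀ f g → ⟦ f ⟧ ℚᵘ.+ ⟦ g ⟧ ≡ ⟦ f ⊕ g ⟧
⟦⟧-⊕ (x − y ÷ suc d) (z − w ÷ suc e) =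
  cong (λ i → mkℚᵘ i _) (trans (cong₂ ℤ._+_ (*-distribʳ-⊖ x y (suc e)) (*-distribʳ-⊖ z w (suc d)))
                                (m⊖n+p⊖q≡m+p⊖n+q (x * suc e) (y * suc e) (z * suc d) (w * suc d)))

⟦⟧-⊝ : ∀ f → ℚᵘ.- ⟦ f ⟧ ≡ ⟦ ⊝ f ⟧
⟦⟧-⊝ (x − y ÷ suc d) = cong (λ i → mkℚᵘ i d) (sym (ℤP.⊖-swap y x))

⟦⟧-cross : ∀ f g → Cross f g → ⟦ f ⟧ ℚᵘ.≃ ⟦ g ⟧
⟦⟧-cross (x − y ÷ suc d) (z − w ÷ suc e) eq = *≡* (begin
  (x ⊖ y) ℤ.* + suc e       ≡⟨ *-distribʳ-⊖ x y (suc e) ⟩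
  (x * suc e) ⊖ (y * suc e) ≡⟨ m+q≡n+p⇒m⊖n≡p⊖q (x * suc e) (y * suc e) (z * suc d) (w * suc d) eq ⟩
  (z * suc d) ⊖ (w * suc d) ≡⟨ *-distribʳ-⊖ z w (suc d) ⟨
  (z ⊖ w) ℤ.* + suc d       ∎)
  where open ≡-Reasoning

infix 3 _≈ᶠ_
record _≈ᶠ_ (p : ℚ) (f : Fraction) : Set where
  constructor fraction
  field toℚᵘ≃ : ℚ.toℚᵘ p ℚᵘ.≃ ⟦ f ⟧
open _≈ᶠ_

≈ᶠ-/ : ∀ a d .{{_ : NonZero d}} → + a ℚ./ d ≈ᶠ a − 0 ÷ d
≈ᶠ-/ a (suc d) = fraction (ℚP.toℚᵘ-fromℚᵘ (mkℚᵘ (+ a) d))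

≈ᶠ-+ : ∀ {p q f g} → p ≈ᶠ f → q ≈ᶠ g → p ℚ.+ q ≈ᶠ f ⊕ g
≈ᶠ-+ {p} {q} {f} {g} (fraction p≃f) (fraction q≃g) = fraction (begin
  ℚ.toℚᵘ (p ℚ.+ q)          ≈⟨ ℚP.toℚᵘ-homo-+ p q ⟩
  ℚ.toℚᵘ p ℚᵘ.+ ℚ.toℚᵘ q    ≈⟨ ℚᵘP.+-cong p≃f q≃g ⟩
  ⟦ f ⟧ ℚᵘ.+ ⟦ g ⟧          ≡⟨ ⟦⟧-⊕ f g ⟩
  ⟦ f ⊕ g ⟧                 ∎)
  where open ℚᵘP.≃-Reasoning

≈ᶠ-− : ∀ {p q f g} → p ≈ᶠ f → q ≈ᶠ g → p ℚ.- q ≈ᶠ f ⊕ ⊝ g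
≈ᶠ-− {p} {q} {f} {g} p≈f (fraction q≃g) = ≈ᶠ-+ {q = ℚ.- q} {g = ⊝ g} p≈f (fraction (begin
  ℚ.toℚᵘ (ℚ.- q)   ≈⟨ ℚP.toℚᵘ-homo‿- q ⟩
  ℚᵘ.- ℚ.toℚᵘ q    ≈⟨ ℚᵘP.-‿cong q≃g ⟩
  ℚᵘ.- ⟦ g ⟧       ≡⟨ ⟦⟧-⊝ g ⟩
  ⟦ ⊝ g ⟧          ∎))
  where open ℚᵘP.≃-Reasoning

≈ᶠ-cross : ∀ {p f g} → p ≈ᶠ f → Cross f g → p ≈ᶠ g
≈ᶠ-cross {f = f} {g} (fraction p≃f) fg = fraction (ℚᵘP.≃-trans p≃f (⟦⟧-cross f g fg))

≈ᶠ-≡ : ∀ {p q f g} → p ≈ᶠ f → q ≈ᶠ g → Cross f g → p ≡ q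
≈ᶠ-≡ p≈f (fraction q≃g) fg =
  ℚP.toℚᵘ-injective (ℚᵘP.≃-trans (toℚᵘ≃ (≈ᶠ-cross p≈f fg)) (ℚᵘP.≃-sym q≃g))

∣numerator∣ denominator : Fraction → ℕ
∣numerator∣ (x − y ÷ d) = ℤ.∣ x ⊖ y ∣
denominator (x − y ÷ d) = d

≈ᶠ-∣∣< : ∀ {p f m e} .{c : Coprime (suc m) (suc e)} → p ≈ᶠ f →
         ∣numerator∣ f * suc e < suc m * denominator f → ℚ.∣ p ∣ ℚ.< mkℚ (+ suc m) e c
≈ᶠ-∣∣< {p} {x − y ÷ suc d} {m} {e} (fraction p≃f) lt = ℚP.toℚᵘ-cancel-<
  (ℚᵘP.<-respˡ-≃ (ℚᵘP.≃-sym ∣p∣≃)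
    (*<* (subst₂ ℤ._<_ (ℤP.pos-* ℤ.∣ x ⊖ y ∣ (suc e)) (ℤP.pos-* (suc m) (suc d)) (ℤ.+<+ lt))))
  where
  ∣p∣≃ : ℚ.toℚᵘ ℚ.∣ p ∣ ℚᵘ.≃ mkℚᵘ (+ ℤ.∣ x ⊖ y ∣) d
  ∣p∣≃ = ℚᵘP.≃-trans (ℚP.toℚᵘ-homo-∣-∣ p) (ℚᵘP.∣-∣-cong p≃f)

doubleStep : ℕ → ℕ → ℕ
doubleStep n x = if n ≤ᵇ 2 * x then 2 * x ∸ n else 2 * x

doubleStep-≥ : ∀ {n} x → n ≤ 2 * x → doubleStep n x ≡ 2 * x ∸ n
doubleStep-≥ {n} x n≤2x with n ≤ᵇ 2 * x | ≤⇒≤ᵇ n≤2x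
... | true | _ = refl

doubleStep-< : ∀ {n} x → 2 * x < n → doubleStep n x ≡ 2 * x
doubleStep-< {n} x 2x<n with n ≤ᵇ 2 * x in eq
... | true  = contradiction (≤ᵇ⇒≤ n (2 * x) (subst T (sym eq) tt)) (<⇒≱ 2x<n)
... | false = refl

doubleStep-≤ : ∀ {n x} → x ≤ n → doubleStep n x ≤ n
doubleStep-≤ {n} {x} x≤n with n ≤? 2 * x
... | yes n≤2x = begin
  doubleStep n x ≡⟨ doubleStep-≥ x n≤2x ⟩
  2 * x ∸ n      ≤⟨ ∸-monoˡ-≤ n (*-monoʳ-≤ 2 x≤n) ⟩
  2 * n ∸ n      ≡⟨ m+n∸m≡n n (1 * n) ⟩
  1 * n          ≡⟨ *-identityˡ n ⟩
  n              ∎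
  where open ≤-Reasoning
... | no n≰2x = subst (_≤ n) (sym (doubleStep-< x (≰⇒> n≰2x))) (<⇒≤ (≰⇒> n≰2x))

module _ {n} (n-odd : ¬ 2 ∣ n) where
  private
    doubled : ∀ x y → x + y ≡ n → 2 * x + 2 * y ≡ n + n
    doubled x y x+y≡n = begin
      2 * x + 2 * y ≡⟨ *-distribˡ-+ 2 x y ⟨
      2 * (x + y)   ≡⟨ cong (2 *_) x+y≡n ⟩
      2 * n         ≡⟨ cong (λ m → n + m) (+-identityʳ n) ⟩
      n + n         ∎
      where open ≡-Reasoning

    wrapped : ∀ x y → x + y ≡ n → n ≤ 2 * x → doubleStep n x + doubleStep n y ≡ n
    wrapped x y x+y≡n n≤2x = begin
      doubleStep n x + doubleStep n y ≡⟨ cong₂ _+_ (doubleStep-≥ x n≤2x) (doubleStep-< y 2y<n) ⟩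
      (2 * x ∸ n) + 2 * y             ≡⟨ +-∸-comm (2 * y) n≤2x ⟨
      (2 * x + 2 * y) ∸ n             ≡⟨ cong (_∸ n) (doubled x y x+y≡n) ⟩
      (n + n) ∸ n                     ≡⟨ m+n∸m≡n n n ⟩
      n                               ∎
      where
      open ≡-Reasoning
      2y≤n : 2 * y ≤ n
      2y≤n = +-cancelˡ-≤ n (2 * y) n (≤-trans (+-monoˡ-≤ (2 * y) n≤2x) (≤-reflexive (doubled x y x+y≡n)))
      2y<n : 2 * y < n
      2y<n = ≤∧≢⇒< 2y≤n (λ 2y≡n → n-odd (divides y (trans (sym 2y≡n) (*-comm 2 y))))

  doubleStep-complement : ∀ {x y} → x + y ≡ n → doubleStep n x + doubleStep n y ≡ n
  doubleStep-complement {x} {y} x+y≡n with n ≤? 2 * x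
  ... | yes n≤2x = wrapped x y x+y≡n n≤2x
  ... | no n≰2x  = trans (+-comm (doubleStep n x) _) (wrapped y x (trans (+-comm y x) x+y≡n) n≤2y)
    where
    n≤2y : n ≤ 2 * y
    n≤2y = +-cancelˡ-≤ n n (2 * y) (begin
      n + n         ≡⟨ doubled x y x+y≡n ⟨
      2 * x + 2 * y ≤⟨ +-monoˡ-≤ (2 * y) (<⇒≤ (≰⇒> n≰2x)) ⟩
      n + 2 * y     ∎)
      where open ≤-Reasoning

undecided≤ : ∀ {n} → 1 ≤ n → ∀ t → undecided n t ≤ n
undecided≤ 1≤n zero    = 1≤n
undecided≤ 1≤n (suc t) = doubleStep-≤ (undecided≤ 1≤n t)

decidedAt+undecided : ∀ n t → decidedAt n t + undecided n (suc t) ≡ 2 * undecided n t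
decidedAt+undecided n t with n ≤ᵇ 2 * undecided n t in eq
... | true  = m+[n∸m]≡n (≤ᵇ⇒≤ n _ (subst T (sym eq) tt))
... | false = refl

-- 2 ^ t · Σ_{i<t} undecided n i / 2 ^ i, the scaled partial sums of the survival probabilities.
survivalSum : ℕ → ℕ → ℕ
survivalSum n zero    = 0
survivalSum n (suc t) = 2 * (survivalSum n t + undecided n t)

survivalSum≤ : ∀ {n} → 1 ≤ n → ∀ t → survivalSum n t + 2 * n ≤ n * 2 ^ suc t
survivalSum≤ {n} 1≤n zero = ≤-reflexive (solve (n ∷ []))
survivalSum≤ {n} 1≤n (suc t) = begin
  2 * (A + u) + 2 * n ≤⟨ +-monoˡ-≤ (2 * n) (*-monoʳ-≤ 2 (+-monoʳ-≤ A (undecided≤ 1≤n t))) ⟩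
  2 * (A + n) + 2 * n ≡⟨ regroup A n ⟩
  2 * (A + 2 * n)     ≤⟨ *-monoʳ-≤ 2 (survivalSum≤ 1≤n t) ⟩
  2 * (n * 2 ^ suc t) ≡⟨ swap 2 n (2 ^ suc t) ⟩
  n * 2 ^ suc (suc t) ∎
  where
  open ≤-Reasoning
  regroup : ∀ a b → 2 * (a + b) + 2 * b ≡ 2 * (a + 2 * b)
  regroup = solve-∀
  swap : ∀ a b c → a * (b * c) ≡ b * (a * c)
  swap = solve-∀
  A u : ℕ
  A = survivalSum n t
  u = undecided n t

-- Summation by parts, τ the number of tosses: Σ_{t<T} (t+1) P(τ = t+1) = Σ_{t<T} P(τ > t) − T P(τ > T).
partialE-≈ : ∀ n T → partialE n T ≈ᶠ (survivalSum n T − T * undecided n T ÷ 2 ^ T) {{m^n≢0 2 T}}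
partialE-≈ n zero    = fraction ℚᵘP.≃-refl
partialE-≈ n (suc T) =
  ≈ᶠ-cross (≈ᶠ-+ (partialE-≈ n T) (≈ᶠ-/ (suc T * decidedAt n T) (2 ^ suc T) {{m^n≢0 2 (suc T)}}))
           (by-parts (survivalSum n T) (undecided n T) (decidedAt n T) (undecided n (suc T))
                     (2 ^ T) (decidedAt+undecided n T))
  where
  by-parts : ∀ A u d u' P → d + u' ≡ 2 * u →
    (A * (2 * P) + suc T * d * P) * (2 * P) + suc T * u' * (P * (2 * P))
      ≡ (T * u * (2 * P) + 0 * P) * (2 * P) + 2 * (A + u) * (P * (2 * P))
  by-parts A u d u' P d+u'≡2u = begin
    (A * (2 * P) + suc T * d * P) * (2 * P) + suc T * u' * (P * (2 * P))
      ≡⟨ solve (A ∷ u ∷ d ∷ u' ∷ P ∷ T ∷ []) ⟩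
    2 * P * P * (2 * A + suc T * (d + u'))
      ≡⟨ cong (λ v → 2 * P * P * (2 * A + suc T * v)) d+u'≡2u ⟩
    2 * P * P * (2 * A + suc T * (2 * u))
      ≡⟨ solve (A ∷ u ∷ P ∷ T ∷ []) ⟩
    (T * u * (2 * P) + 0 * P) * (2 * P) + 2 * (A + u) * (P * (2 * P)) ∎
    where open ≡-Reasoning

periodic-≤ : ∀ (f : ℕ → ℕ) p .{{_ : NonZero p}} {C} → (∀ i → f (p + i) ≡ f i) →
             (∀ r → r < p → f r ≤ C) → ∀ t → f t ≤ C
periodic-≤ f p {C} f-periodic f≤C t = subst (_≤ C) (sym f-reduce) (f≤C (t % p) (m%n<n t p))
  where
  f-shift : ∀ q r → f (q * p + r) ≡ f r
  f-shift zero    r = refl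
  f-shift (suc q) r = trans (cong f (+-assoc p (q * p) r)) (trans (f-periodic (q * p + r)) (f-shift q r))
  f-reduce : f t ≡ f (t % p)
  f-reduce = trans (cong f (trans (m≡m%n+[m/n]*n t p) (+-comm (t % p) _))) (f-shift (t / p) (t % p))

n*[1+n]<2^n : ∀ {n} → 5 ≤ n → n * suc n < 2 ^ n
n*[1+n]<2^n {n} 5≤n = subst (λ m → m * suc m < 2 ^ m) (m+[n∸m]≡n 5≤n) (shifted (n ∸ 5))
  where
  shifted : ∀ y → (5 + y) * (6 + y) < 2 ^ (5 + y)
  shifted zero    = ≤ᵇ⇒≤ 31 32 tt
  shifted (suc y) = begin-strict
    (6 + y) * (7 + y)       ≤⟨ m≤m+n ((6 + y) * (7 + y)) (18 + (9 * y + y * y)) ⟩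
    (6 + y) * (7 + y) + (18 + (9 * y + y * y)) ≡⟨ expand y ⟨
    2 * ((5 + y) * (6 + y)) <⟨ *-monoʳ-< 2 (shifted y) ⟩
    2 * 2 ^ (5 + y)         ∎
    where
    open ≤-Reasoning
    expand : ∀ y → 2 * ((5 + y) * (6 + y)) ≡ (6 + y) * (7 + y) + (18 + (9 * y + y * y))
    expand = solve-∀

∣m⊖[n+o]∣≤∣n⊖m∣+o : ∀ m n o → ℤ.∣ m ⊖ (n + o) ∣ ≤ ℤ.∣ n ⊖ m ∣ + o
∣m⊖[n+o]∣≤∣n⊖m∣+o m n o = begin
  ℤ.∣ m ⊖ (n + o) ∣                 ≡⟨ cong (λ k → ℤ.∣ k ⊖ (n + o) ∣) (+-identityʳ m) ⟨
  ℤ.∣ (m + 0) ⊖ (n + o) ∣           ≡⟨ cong ℤ.∣_∣ (m⊖n+p⊖q≡m+p⊖n+q m n 0 o) ⟨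
  ℤ.∣ (m ⊖ n) ℤ.+ (0 ⊖ o) ∣         ≤⟨ ℤP.∣i+j∣≤∣i∣+∣j∣ (m ⊖ n) (0 ⊖ o) ⟩
  ℤ.∣ m ⊖ n ∣ + ℤ.∣ 0 ⊖ o ∣         ≡⟨ cong₂ _+_ (ℤP.∣m⊖n∣≡∣n⊖m∣ m n) (ℤP.∣⊖∣-≤ z≤n) ⟩
  ℤ.∣ n ⊖ m ∣ + o                   ∎
  where open ≤-Reasoning

module _ {n L : ℕ} (1≤L : 1 ≤ L) (reflect : ∀ i → undecided n (L + i) + undecided n i ≡ n) where

  private
    u A : ℕ → ℕ
    u = undecided n
    A = survivalSum n
    N V : ℕ
    N = F L
    V = A L + 2 * n

    1≤n : 1 ≤ n
    1≤n = subst (1 ≤_) (reflect 0) (m≤n+m 1 (u (L + 0)))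

  -- N · 2 ^ t times the tail  Σ_{i ≥ t} u i / 2 ^ i  of the series for V / N
  scaledTail : ℕ → ℤ
  scaledTail t = (2 ^ t * V) ⊖ (N * A t)

  scaledTail-reflect : ∀ i → scaledTail (L + i) ℤ.+ scaledTail i ≡ + (2 * (N * n))
  scaledTail-reflect i = begin
    scaledTail (L + i) ℤ.+ scaledTail i
      ≡⟨ m⊖n+p⊖q≡m+p⊖n+q (2 ^ (L + i) * V) (N * A (L + i)) (2 ^ i * V) (N * A i) ⟩
    (2 ^ (L + i) * V + 2 ^ i * V) ⊖ (N * A (L + i) + N * A i)
      ≡⟨ m+q≡n+p⇒m⊖n≡p⊖q _ (N * A (L + i) + N * A i) _ 0 (trans (+-identityʳ _) (reflect-ℕ i)) ⟩
    + (2 * (N * n)) ∎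
    where
    open ≡-Reasoning
    reflect-ℕ : ∀ i → 2 ^ (L + i) * V + 2 ^ i * V ≡ N * A (L + i) + N * A i + 2 * (N * n)
    reflect-ℕ zero rewrite +-identityʳ L = base (2 ^ L) (A L) n
      where
      base : ∀ P a n → P * (a + 2 * n) + 1 * (a + 2 * n) ≡ suc P * a + suc P * 0 + 2 * (suc P * n)
      base = solve-∀
    reflect-ℕ (suc i) rewrite +-suc L i = begin
      2 * 2 ^ (L + i) * V + 2 * 2 ^ i * V
        ≡⟨ factor (2 ^ (L + i)) (2 ^ i) V ⟩
      2 * (2 ^ (L + i) * V + 2 ^ i * V)
        ≡⟨ cong (2 *_) (reflect-ℕ i) ⟩
      2 * (N * a + N * b + 2 * (N * n))
        ≡⟨ split N a b n ⟩
      2 * (N * a + N * b) + 2 * (N * n) + 2 * (N * n)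
        ≡⟨ cong (λ m → 2 * (N * a + N * b) + 2 * (N * m) + 2 * (N * n)) (reflect i) ⟨
      2 * (N * a + N * b) + 2 * (N * (x + y)) + 2 * (N * n)
        ≡⟨ regroup N a b x y (2 * (N * n)) ⟩
      N * (2 * (a + x)) + N * (2 * (b + y)) + 2 * (N * n) ∎
      where
      open ≡-Reasoning
      a b x y : ℕ
      a = A (L + i)
      b = A i
      x = u (L + i)
      y = u i
      factor : ∀ p q v → 2 * p * v + 2 * q * v ≡ 2 * (p * v + q * v)
      factor = solve-∀
      split : ∀ N a b n → 2 * (N * a + N * b + 2 * (N * n))
                          ≡ 2 * (N * a + N * b) + 2 * (N * n) + 2 * (N * n)
      split = solve-∀
      regroup : ∀ N a b x y c → 2 * (N * a + N * b) + 2 * (N * (x + y)) + c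
                                ≡ N * (2 * (a + x)) + N * (2 * (b + y)) + c
      regroup = solve-∀

  scaledTail-periodic : ∀ i → scaledTail (L + L + i) ≡ scaledTail i
  scaledTail-periodic i = begin
    scaledTail (L + L + i)   ≡⟨ cong scaledTail (+-assoc L L i) ⟩
    scaledTail (L + (L + i)) ≡⟨ ∙-cancelʳ ℤP.+-0-abelianGroup (scaledTail (L + i)) _ _ both≡ ⟩
    scaledTail i             ∎
    where
    open ≡-Reasoning
    both≡ : scaledTail (L + (L + i)) ℤ.+ scaledTail (L + i) ≡ scaledTail i ℤ.+ scaledTail (L + i)
    both≡ = trans (scaledTail-reflect (L + i))
                  (trans (sym (scaledTail-reflect i)) (ℤP.+-comm (scaledTail (L + i)) (scaledTail i)))

  private
    C : ℕ
    C = 2 ^ (L + L) * V + N * (n * 2 ^ (L + L))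

  ∣scaledTail∣≤ : ∀ t → ℤ.∣ scaledTail t ∣ ≤ C
  ∣scaledTail∣≤ = periodic-≤ (λ t → ℤ.∣ scaledTail t ∣) (L + L) {{>-nonZero (≤-trans 1≤L (m≤m+n L L))}}
                            (λ i → cong ℤ.∣_∣ (scaledTail-periodic i)) on-period
    where
    on-period : ∀ r → r < L + L → ℤ.∣ scaledTail r ∣ ≤ C
    on-period r r<2L = begin
      ℤ.∣ scaledTail r ∣              ≤⟨ ℤP.∣m⊝n∣≤m⊔n (2 ^ r * V) (N * A r) ⟩
      2 ^ r * V ⊔ N * A r             ≤⟨ m⊔n≤m+n (2 ^ r * V) (N * A r) ⟩
      2 ^ r * V + N * A r             ≤⟨ +-mono-≤ (*-monoˡ-≤ V (^-monoʳ-≤ 2 (<⇒≤ r<2L))) (*-monoʳ-≤ N A≤) ⟩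
      C                               ∎
      where
      open ≤-Reasoning
      A≤ : A r ≤ n * 2 ^ (L + L)
      A≤ = ≤-trans (m≤m+n (A r) (2 * n)) (≤-trans (survivalSum≤ 1≤n r) (*-monoʳ-≤ n (^-monoʳ-≤ 2 r<2L)))

  error-numerator≤ : ∀ T → ℤ.∣ (A T * N + 0 * 2 ^ T) ⊖ (T * u T * N + V * 2 ^ T) ∣ ≤ C + N * (T * n)
  error-numerator≤ T = begin
    ℤ.∣ (A T * N + 0 * P) ⊖ (T * u T * N + V * P) ∣ ≡⟨ cong ℤ.∣_∣ numerator≡ ⟩
    ℤ.∣ (N * A T) ⊖ (P * V + N * (T * u T)) ∣       ≤⟨ ∣m⊖[n+o]∣≤∣n⊖m∣+o (N * A T) (P * V) (N * (T * u T)) ⟩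
    ℤ.∣ scaledTail T ∣ + N * (T * u T)              ≤⟨ +-mono-≤ (∣scaledTail∣≤ T) (*-monoʳ-≤ N Tu≤Tn) ⟩
    C + N * (T * n)                                 ∎
    where
    open ≤-Reasoning
    P : ℕ
    P = 2 ^ T
    rearrange : ∀ a N P t u v → (a * N + 0 * P) + (P * v + N * (t * u)) ≡ (t * u * N + v * P) + N * a
    rearrange = solve-∀
    numerator≡ : (A T * N + 0 * P) ⊖ (T * u T * N + V * P) ≡ (N * A T) ⊖ (P * V + N * (T * u T))
    numerator≡ = m+q≡n+p⇒m⊖n≡p⊖q (A T * N + 0 * P) (T * u T * N + V * P) (N * A T) (P * V + N * (T * u T))
                                 (rearrange (A T) N P T (u T) V)
    Tu≤Tn : T * u T ≤ T * n
    Tu≤Tn = *-monoʳ-≤ T (undecided≤ 1≤n T)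

  expectedTosses : ExpectedTosses≡ n (+ (survivalSum n L + 2 * n) ℚ./ F L)
  expectedTosses (mkℚ +0       _ _) (ℚ.*<* (ℤ.+<+ ()))
  expectedTosses (mkℚ -[1+ _ ] _ _) (ℚ.*<* ())
  expectedTosses (mkℚ +[1+ m ] e _) _ = c + 5 , close
    where
    c : ℕ
    c = (C + N * n) * suc e
    close : ∀ T → c + 5 ≤ T → ℚ.∣ partialE n T ℚ.- + V ℚ./ N ∣ ℚ.< mkℚ (+ suc m) e _
    close T c+5≤T = ≈ᶠ-∣∣< (≈ᶠ-− (partialE-≈ n T) (≈ᶠ-/ V N)) (begin-strict
      ℤ.∣ (A T * N + 0 * 2 ^ T) ⊖ (T * u T * N + V * 2 ^ T) ∣ * suc e
                                   ≤⟨ *-monoˡ-≤ (suc e) (error-numerator≤ T) ⟩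
      (C + N * (T * n)) * suc e    ≤⟨ *-monoˡ-≤ (suc e) (subst (C + N * (T * n) ≤_) (sym (expand C N n T)) (m≤m+n _ _)) ⟩
      (C + N * n) * suc T * suc e  ≡⟨ swap (C + N * n) (suc T) (suc e) ⟩
      c * suc T                    ≤⟨ *-monoˡ-≤ (suc T) (≤-trans (m≤m+n c 5) c+5≤T) ⟩
      T * suc T                    <⟨ n*[1+n]<2^n (≤-trans (m≤n+m 5 c) c+5≤T) ⟩
      2 ^ T                        ≤⟨ m≤m*n (2 ^ T) N ⟩
      2 ^ T * N                    ≤⟨ m≤n*m (2 ^ T * N) (suc m) ⟩
      suc m * (2 ^ T * N)          ∎)
      where
      open ≤-Reasoning
      expand : ∀ C N n T → (C + N * n) * suc T ≡ C + N * (T * n) + (N * n + C * T)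
      expand = solve-∀
      swap : ∀ x y z → x * y * z ≡ x * z * y
      swap = solve-∀

2∣2^ : ∀ {t} → 1 ≤ t → 2 ∣ 2 ^ t
2∣2^ {suc t} _ = m∣m*n (2 ^ t)

-- Before toss L the only assignment happens at toss M: undecided n t = 2 ^ t for t < M,
-- and afterwards undecided n (M + j) = 2 ^ j (2 ^ M ∸ n) until j = s.
module _ {s M L n : ℕ} (1≤M : 1 ≤ M) (L≡M+s : L ≡ M + s) (n*Fs≡FL : n * F s ≡ F L) where

  private
    u A : ℕ → ℕ
    u = undecided n
    A = survivalSum n
    a X : ℕ
    a = 2 ^ s
    X = 2 ^ M

    instance
      a≢0 : NonZero a
      a≢0 = m^n≢0 2 s

    2^L≡X*a : 2 ^ L ≡ X * a
    2^L≡X*a = trans (cong (2 ^_) L≡M+s) (^-distribˡ-+-* 2 M s)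

    n*[1+a]≡1+X*a : n * suc a ≡ suc (X * a)
    n*[1+a]≡1+X*a = trans n*Fs≡FL (cong suc 2^L≡X*a)

  <n-if-2*≤2^M : ∀ y → 2 * y ≤ X → y < n
  <n-if-2*≤2^M y 2y≤X = *-cancelʳ-< (suc a) y n (begin-strict
    y * suc a       ≡⟨ *-suc y a ⟩
    y + y * a       ≤⟨ +-monoˡ-≤ (y * a) (m≤m*n y a) ⟩
    y * a + y * a   ≡⟨ *-distribʳ-+ a y y ⟨
    (y + y) * a     ≡⟨ cong (λ m → (y + m) * a) (+-identityʳ y) ⟨
    2 * y * a       ≤⟨ *-monoˡ-≤ a 2y≤X ⟩
    X * a           <⟨ n<1+n (X * a) ⟩
    suc (X * a)     ≡⟨ n*[1+a]≡1+X*a ⟨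
    n * suc a       ∎)
    where open ≤-Reasoning

  undecided-early : ∀ t → t < M → u t ≡ 2 ^ t
  undecided-early zero    _     = refl
  undecided-early (suc t) 1+t<M = begin
    doubleStep n (u t) ≡⟨ doubleStep-< (u t) 2*u<n ⟩
    2 * u t            ≡⟨ cong (2 *_) ih ⟩
    2 ^ suc t          ∎
    where
    open ≡-Reasoning
    ih : u t ≡ 2 ^ t
    ih = undecided-early t (<-trans (n<1+n t) 1+t<M)
    2*u<n : 2 * u t < n
    2*u<n = subst (λ v → 2 * v < n) (sym ih) (<n-if-2*≤2^M (2 ^ suc t) (^-monoʳ-≤ 2 1+t<M))

  n≤2^M : n ≤ X
  n≤2^M = *-cancelʳ-≤ n X (suc a) (begin
    n * suc a    ≡⟨ n*[1+a]≡1+X*a ⟩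
    1 + X * a    ≤⟨ +-monoˡ-≤ (X * a) (m^n>0 2 M) ⟩
    X + X * a    ≡⟨ *-suc X a ⟨
    X * suc a    ∎)
    where open ≤-Reasoning

  undecided-M : u M ≡ X ∸ n
  undecided-M = begin
    u M                 ≡⟨ cong u M≡1+M' ⟩
    doubleStep n (u M') ≡⟨ doubleStep-≥ (u M') (subst (n ≤_) (sym 2*u≡X) n≤2^M) ⟩
    2 * u M' ∸ n        ≡⟨ cong (_∸ n) 2*u≡X ⟩
    X ∸ n               ∎
    where
    open ≡-Reasoning
    M' : ℕ
    M' = pred M
    M≡1+M' : M ≡ suc M'
    M≡1+M' = sym (suc-pred M {{>-nonZero 1≤M}})
    2*u≡X : 2 * u M' ≡ X
    2*u≡X = trans (cong (2 *_) (undecided-early M' (≤-reflexive (sym M≡1+M'))))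
                  (cong (2 ^_) (sym M≡1+M'))

  private
    factor-2 : ∀ x y z → 2 * x * y + 2 * z ≡ 2 * (x * y + z)
    factor-2 = solve-∀

  undecided-M*[1+a] : u M * suc a + 1 ≡ X
  undecided-M*[1+a] = +-cancelʳ-≡ (X * a) _ _ (begin
    u M * suc a + 1 + X * a   ≡⟨ +-assoc (u M * suc a) 1 (X * a) ⟩
    u M * suc a + suc (X * a) ≡⟨ cong (λ v → u M * suc a + v) n*[1+a]≡1+X*a ⟨
    u M * suc a + n * suc a   ≡⟨ *-distribʳ-+ (suc a) (u M) n ⟨
    (u M + n) * suc a         ≡⟨ cong (λ v → (v + n) * suc a) undecided-M ⟩
    (X ∸ n + n) * suc a       ≡⟨ cong (_* suc a) (m∸n+n≡m n≤2^M) ⟩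
    X * suc a                 ≡⟨ *-suc X a ⟩
    X + X * a                 ∎)
    where open ≡-Reasoning

  late-2*undecided<n : ∀ j → suc j ≤ s → u (M + j) * suc a + 2 ^ j ≡ 2 ^ (M + j) →
                       2 * u (M + j) < n
  late-2*undecided<n j 1+j≤s eq = *-cancelʳ-< (suc a) (2 * w) n (begin-strict
    2 * w * suc a               ≤⟨ m≤m+n (2 * w * suc a) (2 * 2 ^ j) ⟩
    2 * w * suc a + 2 * 2 ^ j   ≡⟨ factor-2 w (suc a) (2 ^ j) ⟩
    2 * (w * suc a + 2 ^ j)     ≡⟨ cong (2 *_) eq ⟩
    2 ^ suc (M + j)             ≤⟨ ^-monoʳ-≤ 2 (subst (_≤ M + s) (+-suc M j) (+-monoʳ-≤ M 1+j≤s)) ⟩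
    2 ^ (M + s)                 ≡⟨ ^-distribˡ-+-* 2 M s ⟩
    X * a                       <⟨ n<1+n (X * a) ⟩
    suc (X * a)                 ≡⟨ n*[1+a]≡1+X*a ⟨
    n * suc a                   ∎)
    where
    open ≤-Reasoning
    w : ℕ
    w = u (M + j)

  undecided-late : ∀ j → j ≤ s → u (M + j) * suc a + 2 ^ j ≡ 2 ^ (M + j)
  undecided-late zero    _     rewrite +-identityʳ M = undecided-M*[1+a]
  undecided-late (suc j) 1+j≤s rewrite +-suc M j = begin
    doubleStep n w * suc a + 2 * 2 ^ j ≡⟨ cong (λ v → v * suc a + 2 * 2 ^ j) (doubleStep-< w 2w<n) ⟩
    2 * w * suc a + 2 * 2 ^ j          ≡⟨ factor-2 w (suc a) (2 ^ j) ⟩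
    2 * (w * suc a + 2 ^ j)            ≡⟨ cong (2 *_) ih ⟩
    2 * 2 ^ (M + j)                    ∎
    where
    open ≡-Reasoning
    w : ℕ
    w = u (M + j)
    ih : w * suc a + 2 ^ j ≡ 2 ^ (M + j)
    ih = undecided-late j (<⇒≤ 1+j≤s)
    2w<n : 2 * w < n
    2w<n = late-2*undecided<n j 1+j≤s ih

  undecided-L : u L + 1 ≡ n
  undecided-L = *-cancelʳ-≡ (u L + 1) n (suc a) (begin
    (u L + 1) * suc a          ≡⟨ expand (u L) a ⟩
    u L * suc a + a + 1        ≡⟨ cong (λ t → u t * suc a + a + 1) L≡M+s ⟩
    u (M + s) * suc a + a + 1  ≡⟨ cong (_+ 1) (undecided-late s ≤-refl) ⟩
    2 ^ (M + s) + 1            ≡⟨ cong (λ t → 2 ^ t + 1) L≡M+s ⟨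
    2 ^ L + 1                  ≡⟨ +-comm (2 ^ L) 1 ⟩
    F L                        ≡⟨ n*Fs≡FL ⟨
    n * suc a                  ∎)
    where
    open ≡-Reasoning
    expand : ∀ x y → (x + 1) * suc y ≡ x * suc y + y + 1
    expand = solve-∀

  n-odd : ¬ 2 ∣ n
  n-odd 2∣n = contradiction (∣1⇒≡1 2∣1) λ ()
    where
    2∣2^L : 2 ∣ 2 ^ L
    2∣2^L = 2∣2^ (subst (1 ≤_) (sym L≡M+s) (≤-trans 1≤M (m≤m+n M s)))
    2∣2^L+1 : 2 ∣ 2 ^ L + 1
    2∣2^L+1 = subst (2 ∣_) (trans n*Fs≡FL (+-comm 1 (2 ^ L))) (∣-trans 2∣n (m∣m*n (F s)))
    2∣1 : 2 ∣ 1
    2∣1 = ∣m+n∣m⇒∣n 2∣2^L+1 2∣2^L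

  undecided-reflect : ∀ i → u (L + i) + u i ≡ n
  undecided-reflect zero    rewrite +-identityʳ L = undecided-L
  undecided-reflect (suc i) rewrite +-suc L i =
    doubleStep-complement n-odd {u (L + i)} {u i} (undecided-reflect i)

  survivalSum-early : ∀ t → t ≤ M → A t ≡ t * 2 ^ t
  survivalSum-early zero    _   = refl
  survivalSum-early (suc t) t<M = begin
    2 * (A t + u t)         ≡⟨ cong₂ (λ x y → 2 * (x + y)) (survivalSum-early t (<⇒≤ t<M))
                                                            (undecided-early t t<M) ⟩
    2 * (t * 2 ^ t + 2 ^ t) ≡⟨ regroup t (2 ^ t) ⟩
    suc t * 2 ^ suc t       ∎
    where
    open ≡-Reasoning
    regroup : ∀ t p → 2 * (t * p + p) ≡ suc t * (2 * p)
    regroup = solve-∀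

  survivalSum-late : ∀ j → j ≤ s → A (M + j) * suc a + j * 2 ^ j ≡ (M * suc a + j) * 2 ^ (M + j)
  survivalSum-late zero _ rewrite +-identityʳ M | survivalSum-early M ≤-refl = regroup M (suc a) X
    where
    regroup : ∀ m b x → m * x * b + 0 ≡ (m * b + 0) * x
    regroup = solve-∀
  survivalSum-late (suc j) 1+j≤s rewrite +-suc M j = begin
    2 * (A (M + j) + u (M + j)) * suc a + suc j * (2 * 2 ^ j)
      ≡⟨ split (A (M + j)) (u (M + j)) (suc a) j (2 ^ j) ⟩
    2 * (A (M + j) * suc a + j * 2 ^ j) + 2 * (u (M + j) * suc a + 2 ^ j)
      ≡⟨ cong₂ (λ x y → 2 * x + 2 * y) (survivalSum-late j j≤s) (undecided-late j j≤s) ⟩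
    2 * ((M * suc a + j) * 2 ^ (M + j)) + 2 * 2 ^ (M + j)
      ≡⟨ merge (M * suc a) j (2 ^ (M + j)) ⟩
    (M * suc a + suc j) * (2 * 2 ^ (M + j)) ∎
    where
    open ≡-Reasoning
    j≤s : j ≤ s
    j≤s = <⇒≤ 1+j≤s
    split : ∀ x w b j e → 2 * (x + w) * b + suc j * (2 * e) ≡ 2 * (x * b + j * e) + 2 * (w * b + e)
    split = solve-∀
    merge : ∀ c j y → 2 * ((c + j) * y) + 2 * y ≡ (c + suc j) * (2 * y)
    merge = solve-∀

  survivalSum-L : A L + n * (s * a) ≡ L * 2 ^ L
  survivalSum-L = *-cancelʳ-≡ _ _ (suc a) (begin
    (A L + n * (s * a)) * suc a
      ≡⟨ expand (A L) n s a ⟩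
    A L * suc a + s * a * (n * suc a)
      ≡⟨ cong₂ (λ t v → A t * suc a + s * a * v) L≡M+s n*[1+a]≡1+X*a ⟩
    A (M + s) * suc a + s * a * suc (X * a)
      ≡⟨ regroup (A (M + s) * suc a) s a (X * a) ⟩
    (A (M + s) * suc a + s * a) + s * a * (X * a)
      ≡⟨ cong (_+ s * a * (X * a)) (survivalSum-late s ≤-refl) ⟩
    (M * suc a + s) * 2 ^ (M + s) + s * a * (X * a)
      ≡⟨ cong (λ v → (M * suc a + s) * v + s * a * (X * a)) (^-distribˡ-+-* 2 M s) ⟩
    (M * suc a + s) * (X * a) + s * a * (X * a)
      ≡⟨ collect M a s (X * a) ⟩
    (M + s) * (X * a) * suc a
      ≡⟨ cong₂ (λ x y → x * y * suc a) L≡M+s 2^L≡X*a ⟨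
    L * 2 ^ L * suc a ∎)
    where
    open ≡-Reasoning
    expand : ∀ x n s a → (x + n * (s * a)) * suc a ≡ x * suc a + s * a * (n * suc a)
    expand = solve-∀
    regroup : ∀ y s a z → y + s * a * suc z ≡ (y + s * a) + s * a * z
    regroup = solve-∀
    collect : ∀ m a s z → (m * suc a + s) * z + s * a * z ≡ (m + s) * z * suc a
    collect = solve-∀

expectedValue-closedForm : ∀ s a m S D X .{{_ : NonZero D}} → m * suc a ≡ D → S + m * (s * a) ≡ X →
  + X ℚ./ D ℚ.- + (s * a) ℚ./ suc a ℚ.+ + 2 ℚ./ suc a ≡ + (S + 2 * m) ℚ./ D
expectedValue-closedForm s a m S _ _ refl refl =
  ≈ᶠ-≡ (≈ᶠ-+ (≈ᶠ-− (≈ᶠ-/ (S + m * (s * a)) (m * suc a)) (≈ᶠ-/ (s * a) (suc a))) (≈ᶠ-/ 2 (suc a)))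
       (≈ᶠ-/ (S + 2 * m) (m * suc a))
       (solve (s ∷ a ∷ m ∷ S ∷ []))

closedForms-agree : ∀ s k P a →
  + (s * (2 * k + 1) * P) ℚ./ suc P ℚ.- + (s * a) ℚ./ suc a ℚ.+ + 2 ℚ./ suc a
  ≡ + (2 * s * k) ℚ./ 1 ℚ.+ + (s + 2) ℚ./ suc a ℚ.- + (s * (2 * k + 1)) ℚ./ suc P
closedForms-agree s k P a =
  ≈ᶠ-≡ (≈ᶠ-+ (≈ᶠ-− (≈ᶠ-/ (s * (2 * k + 1) * P) (suc P)) (≈ᶠ-/ (s * a) (suc a))) (≈ᶠ-/ 2 (suc a)))
       (≈ᶠ-− (≈ᶠ-+ (≈ᶠ-/ (2 * s * k) 1) (≈ᶠ-/ (s + 2) (suc a))) (≈ᶠ-/ (s * (2 * k + 1)) (suc P)))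
       (solve (s ∷ k ∷ P ∷ a ∷ []))

1+x∣1+x^[2k+1] : ∀ x k → suc x ∣ suc (x ^ (2 * k + 1))
1+x∣1+x^[2k+1] x zero    = subst (λ y → suc x ∣ suc y) (sym (*-identityʳ x)) ∣-refl
1+x∣1+x^[2k+1] x (suc k) = subst (λ e → suc x ∣ suc (x ^ e)) (sym (odd-suc k))
  (∣m+n∣m⇒∣n (subst (suc x ∣_) (sym (shift x (x ^ (2 * k + 1))))
                    (∣m∣n⇒∣m+n (∣-trans (1+x∣1+x^[2k+1] x k) (n∣m*n (x * x))) ∣-refl))
             (m∣m*n x))
  where
  odd-suc : ∀ k → 2 * suc k + 1 ≡ suc (suc (2 * k + 1))
  odd-suc = solve-∀
  shift : ∀ x y → suc x * x + suc (x * (x * y)) ≡ x * x * suc y + suc x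
  shift = solve-∀

Fs∣F[s*[2k+1]] : ∀ s k → F s ∣ F (s * (2 * k + 1))
Fs∣F[s*[2k+1]] s k = subst (λ t → F s ∣ suc t) (^-*-assoc 2 s (2 * k + 1)) (1+x∣1+x^[2k+1] (2 ^ s) k)

mainTheorem7 : (s k : ℕ) → 1 ≤ s → 1 ≤ k →
    ExpectedTosses≡ (F (s * (2 * k + 1)) / F s)
      ((+ (s * (2 * k + 1) * 2 ^ (s * (2 * k + 1)))) ℚ./ F (s * (2 * k + 1))
        ℚ.- (+ (s * 2 ^ s)) ℚ./ F s ℚ.+ (+ 2) ℚ./ F s)
    × ((+ (s * (2 * k + 1) * 2 ^ (s * (2 * k + 1)))) ℚ./ F (s * (2 * k + 1))
        ℚ.- (+ (s * 2 ^ s)) ℚ./ F s ℚ.+ (+ 2) ℚ./ F s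
      ≡ (+ (2 * s * k)) ℚ./ 1 ℚ.+ (+ (s + 2)) ℚ./ F s
        ℚ.- (+ (s * (2 * k + 1))) ℚ./ F (s * (2 * k + 1)))
mainTheorem7 s k 1≤s 1≤k =
  subst (ExpectedTosses≡ n) (sym expectedValue≡) (expectedTosses 1≤L reflect) ,
  closedForms-agree s k (2 ^ L) (2 ^ s)
  where
  L M n : ℕ
  L = s * (2 * k + 1)
  M = s * (2 * k)
  n = F L / F s
  L≡M+s : L ≡ M + s
  L≡M+s = trans (*-distribˡ-+ s (2 * k) 1) (cong (λ t → M + t) (*-identityʳ s))
  1≤M : 1 ≤ M
  1≤M = *-mono-≤ 1≤s (≤-trans 1≤k (m≤m+n k (k + 0)))
  1≤L : 1 ≤ L
  1≤L = ≤-trans 1≤M (≤-trans (m≤m+n M s) (≤-reflexive (sym L≡M+s)))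
  n*Fs≡FL : n * F s ≡ F L
  n*Fs≡FL = m/n*n≡m (Fs∣F[s*[2k+1]] s k)
  reflect : ∀ i → undecided n (L + i) + undecided n i ≡ n
  reflect = undecided-reflect 1≤M L≡M+s n*Fs≡FL
  expectedValue≡ : + (L * 2 ^ L) ℚ./ F L ℚ.- + (s * 2 ^ s) ℚ./ F s ℚ.+ + 2 ℚ./ F s
                   ≡ + (survivalSum n L + 2 * n) ℚ./ F L
  expectedValue≡ = expectedValue-closedForm s (2 ^ s) n (survivalSum n L) (F L) (L * 2 ^ L)
                     n*Fs≡FL (survivalSum-L 1≤M L≡M+s n*Fs≡FL)
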